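{- Let $A$ be a finite or countable alphabet and let $\theta$ be a literal (anti)morphism onto $A^*$ (see context). Let $X\subseteq A^*$ be a $\theta$-invariant set, and let $Y$ be the minimal generating set of the smallest $\theta$-invariant free submonoid of $A^*$ which contains $X$. If $X$ is not a code, then $|Y|\le |X|-1$.
   Context: $A^*$ is the free monoid over $A$, with empty word $\varepsilon$. Standing assumption: $\theta:A^*\to A^*$ is a one-to-one correspondence of $A^*$ onto itself, is literal ($\theta(A)\subseteq A$), and is either a morphism ($\theta(xy)=\theta(x)\theta(y)$) or an antimorphism ($\theta(\varepsilon)=\varepsilon$ and $\theta(xy)=\theta(y)\theta(x)$ for all words $x,y$). A set $X$ is $\theta$-invariant if $\theta(X)=X$; a submonoid $M$ is $\theta$-invariant if $\theta(M)=M$. A set $X\subseteq A^*$ is a code if every equation $x_1\cdots x_m=y_1\cdots y_n$ with all $x_i,y_j\in X$ implies $m=n$ and $x_i=y_i$ for all $i$; a submonoid is free if it is generated by a code. The intersection of any non-empty family of $\theta$-invariant free submonoids of $A^*$ is a $\theta$-invariant free submonoid, so the smallest one containing $X$ exists. The minimal generating set of a submonoid $M$ is $(M\setminus\{\varepsilon\})\setminus(M\setminus\{\varepsilon\})^2$. -}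

module Defs where

open import Data.Nat using (ℕ)
open import Data.List using (List; []; [_]; _++_; concat)
open import Data.List.Relation.Unary.All using (All)
open import Data.Product using (Σ; ∃; _×_; _,_)
open import Data.Sum using (_⊎_)
open import Relation.Nullary using (¬_)
open import Relation.Binary.PropositionalEquality using (_≡_; _≢_)
open import Function.Definitions using (Injective; Bijective)

Countable : Set → Set
Countable A = Σ (A → ℕ) λ enc → Injective _≡_ _≡_ enc

module _ {A : Set} where

  Word : Set
  Word = List A

  WSet : Set₁
  WSet = Word → Set

  _⊆_ : WSet → WSet → Set
  X ⊆ Y = ∀ w → X w → Y w

  Literal : (Word → Word) → Set
  Literal θ = ∀ a → ∃ λ b → θ [ a ] ≡ [ b ]

  IsMorphism : (Word → Word) → Set
  IsMorphism θ = ∀ x y → θ (x ++ y) ≡ θ x ++ θ y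

  IsAntimorphism : (Word → Word) → Set
  IsAntimorphism θ = (θ [] ≡ []) × (∀ x y → θ (x ++ y) ≡ θ y ++ θ x)

  LiteralBijAnti/Morphism : (Word → Word) → Set
  LiteralBijAnti/Morphism θ =
    Bijective _≡_ _≡_ θ × Literal θ × (IsMorphism θ ⊎ IsAntimorphism θ)

  θInvariant : (Word → Word) → WSet → Set
  θInvariant θ X = (∀ w → X w → X (θ w)) × (∀ w → X w → ∃ λ v → X v × θ v ≡ w)

  IsCode : WSet → Set
  IsCode X = ∀ (xs ys : List Word) → All X xs → All X ys →
             concat xs ≡ concat ys → xs ≡ ys

  Star : WSet → WSet
  Star X w = ∃ λ (xs : List Word) → All X xs × concat xs ≡ w

  IsSubmonoid : WSet → Set
  IsSubmonoid M = M [] × (∀ u v → M u → M v → M (u ++ v))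

  IsFreeSubmonoid : WSet → Set₁
  IsFreeSubmonoid M = IsSubmonoid M ×
    (Σ WSet λ C → IsCode C × (∀ w → M w → Star C w) × (∀ w → Star C w → M w))

  IsθInvFreeSubmonoid : (Word → Word) → WSet → Set₁
  IsθInvFreeSubmonoid θ M = IsFreeSubmonoid M × θInvariant θ M

  IsSmallestθInvFreeHull : (Word → Word) → WSet → WSet → Set₁
  IsSmallestθInvFreeHull θ X M =
    IsθInvFreeSubmonoid θ M × X ⊆ M ×
    (∀ (N : WSet) → IsθInvFreeSubmonoid θ N → X ⊆ N → M ⊆ N)

  MinGen : WSet → WSet
  MinGen M w = (M w × w ≢ []) ×
    ¬ (∃ λ u → ∃ λ v → M u × u ≢ [] × M v × v ≢ [] × w ≡ u ++ v)

-- Let C be the code generating the hull M. Every x ∈ X factors uniquely over C; call F and L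
-- the sets of first and last C-factors of the elements of X. The words whose C-factorisation
-- begins in F and ends in L form a submonoid N, free because such a factorisation cuts uniquely
-- into blocks at the places where an L-factor is followed by an F-factor. Since θ permutes C and
-- maps F, L onto themselves (onto each other for an antimorphism), N is θ-invariant; it contains X,
-- so it contains M, and therefore every element of C is the first factor of some x ∈ X. If X is
-- not a code, then ε ∈ X or two elements of X have the same first factor (otherwise the first
-- factor determines each x, and X would be a code), so C has at most |X| − 1 elements.
module Submission where

open import Defs
open import Data.Nat using (_≤_; _∸_)
import Data.Nat.Properties as ℕ
open import Data.List
  using (List; []; _∷_; _++_; [_]; _∷ʳ_; concat; concatMap; map; reverse; filter; mapMaybe; head; last; length)
open import Data.List.Properties
  using (∷-injective; ∷-injectiveˡ; ∷-injectiveʳ; ++-identityʳ; ++-identityʳ-unique; ++-conicalˡ;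
         ++-conicalʳ; ++-cancelˡ; concat-++; unfold-reverse; reverse-involutive; head-map; last-map;
         length-mapMaybe; filter-notAll)
import Data.List.Properties as List
open import Data.List.Relation.Unary.All as All using (All; []; _∷_)
import Data.List.Relation.Unary.All.Properties as Allₚ
open import Data.List.Relation.Unary.Any as Any using (Any; any?)
import Data.List.Relation.Unary.Any.Properties as Anyₚ
open import Data.List.Relation.Unary.Linked using (Linked; []; [-]; _∷_)
open import Data.List.Membership.Propositional using (_∈_; find; lose)
open import Data.List.Membership.Propositional.Properties using (∈-filter⁺)
import Data.List.Membership.DecPropositional as DecMembership
open import Data.List.Relation.Unary.Unique.Propositional using (Unique)
open import Data.Maybe using (Maybe; just; nothing)
import Data.Maybe as Maybe
import Data.Maybe.Properties as Maybe
import Data.Maybe.Relation.Unary.All as Maybe using (All; drop-just; just; nothing) renaming (map to All-map)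
import Data.Maybe.Relation.Unary.All.Properties as MaybeAllₚ
import Data.Maybe.Relation.Unary.Any as MaybeAny
open import Data.Product using (∃; ∃₂; _×_; _,_; proj₁; proj₂; swap)
open import Data.Product.Function.NonDependent.Propositional using (_×-⇔_)
open import Data.Sum using (_⊎_; inj₁; inj₂; [_,_]′)
open import Data.Empty using (⊥-elim)
open import Function using (_∘_; id; _⇔_; mk⇔; Equivalence)
open import Function.Bundles using (mk↣)
open import Function.Construct.Composition using (_⇔-∘_)
open import Function.Definitions using (Injective)
open import Relation.Nullary using (¬_; yes; no; ¬?)
open import Relation.Nullary.Decidable using (_×-dec_; _⊎-dec_; via-injection)
open import Relation.Unary using (Decidable)
open import Relation.Binary.Definitions using (DecidableEquality)
open import Relation.Binary.PropositionalEquality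
  using (_≡_; _≢_; refl; sym; trans; cong; cong₂; subst; module ≡-Reasoning)

open Equivalence using (to; from)

Countable⇒DecidableEquality : ∀ {A} → Countable A → DecidableEquality A
Countable⇒DecidableEquality (enc , enc-injective) = via-injection (mk↣ enc-injective) ℕ._≟_

module _ {T : Set} where

  last-∷ʳ : ∀ (s : List T) a → last (s ∷ʳ a) ≡ just a
  last-∷ʳ []          a = refl
  last-∷ʳ (b ∷ [])    a = refl
  last-∷ʳ (b ∷ c ∷ s) a = last-∷ʳ (c ∷ s) a

  last-reverse : ∀ (s : List T) → last (reverse s) ≡ head s
  last-reverse []      = refl
  last-reverse (a ∷ s) = trans (cong last (unfold-reverse a s)) (last-∷ʳ (reverse s) a)

  head-reverse : ∀ (s : List T) → head (reverse s) ≡ last s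
  head-reverse s = trans (sym (last-reverse (reverse s))) (cong last (reverse-involutive s))

  last-++-∷ : ∀ (s : List T) {b t} → last (s ++ b ∷ t) ≡ last (b ∷ t)
  last-++-∷ []          = refl
  last-++-∷ (a ∷ [])    = refl
  last-++-∷ (a ∷ c ∷ s) = last-++-∷ (c ∷ s)

  head-++ : ∀ {s t : List T} → head s ≢ nothing → head (s ++ t) ≡ head s
  head-++ {[]}    nonempty = ⊥-elim (nonempty refl)
  head-++ {_ ∷ _} _        = refl

  All-head-++ : ∀ {P : T → Set} s {t} →
    Maybe.All P (head s) → Maybe.All P (head t) → Maybe.All P (head (s ++ t))
  All-head-++ []      _  pt = pt
  All-head-++ (_ ∷ _) ps _  = ps

  All-last-++ : ∀ {P : T → Set} s {t} →
    Maybe.All P (last s) → Maybe.All P (last t) → Maybe.All P (last (s ++ t))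
  All-last-++ {P} s {[]}    ps _  = subst (Maybe.All P ∘ last) (sym (++-identityʳ s)) ps
  All-last-++ {P} s {_ ∷ _} _  pt = subst (Maybe.All P) (sym (last-++-∷ s)) pt

  All-reverse : ∀ {P : T → Set} {s} → All P s → All P (reverse s)
  All-reverse Ps = All.tabulate (All.lookup Ps ∘ Anyₚ.reverse⁻)

module _ {T U : Set} (f : T → Maybe U) where

  ∈-mapMaybe⁺ : ∀ {l x u} → x ∈ l → f x ≡ just u → u ∈ mapMaybe f l
  ∈-mapMaybe⁺ {l} {u = u} x∈ fx≡ = Anyₚ.mapMaybe⁺ f l (Anyₚ.map⁺ (Any.map just-u x∈))
    where
    just-u : ∀ {y} → _ ≡ y → MaybeAny.Any (u ≡_) (f y)
    just-u refl = subst (MaybeAny.Any (u ≡_)) (sym fx≡) (MaybeAny.just refl)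

module Image {T U : Set} (_≟ᵀ_ : DecidableEquality T) (_≟ᵁ_ : DecidableEquality U) (f : T → Maybe U) where

  Redundant : List T → T → Set
  Redundant l r = f r ≡ nothing ⊎ Any (λ x → x ≢ r × f x ≡ f r) l

  TotalInjectiveOn : List T → Set
  TotalInjectiveOn l =
    (∀ {x} → x ∈ l → f x ≢ nothing) × (∀ {x y} → x ∈ l → y ∈ l → f x ≡ f y → x ≡ y)

  redundant? : ∀ l → Decidable (Redundant l)
  redundant? l r = f r ≟ nothing ⊎-dec any? (λ x → ¬? (x ≟ᵀ r) ×-dec f x ≟ f r) l
    where
    _≟_ : DecidableEquality (Maybe U)
    _≟_ = Maybe.≡-dec _≟ᵁ_

  total-injective-or-redundant : ∀ l → TotalInjectiveOn l ⊎ Any (Redundant l) l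
  total-injective-or-redundant l with any? (redundant? l) l
  ... | yes redundant = inj₂ redundant
  ... | no none = inj₁ ((λ x∈ fx≡ → none (lose x∈ (inj₁ fx≡))) , injective)
    where
    injective : ∀ {x y} → x ∈ l → y ∈ l → f x ≡ f y → x ≡ y
    injective {x} {y} x∈ y∈ fx≡fy with x ≟ᵀ y
    ... | yes x≡y = x≡y
    ... | no x≢y  = ⊥-elim (none (lose y∈ (inj₂ (lose x∈ (x≢y , fx≡fy)))))

  without : T → List T → List T
  without r = filter (λ x → ¬? (x ≟ᵀ r))

  ∈-image-without : ∀ {l r x u} → Redundant l r → x ∈ l → f x ≡ just u → u ∈ mapMaybe f (without r l)
  ∈-image-without {r = r} {x} redundant x∈ fx≡ with x ≟ᵀ r
  ∈-image-without _                   x∈ fx≡ | no x≢r = ∈-mapMaybe⁺ f (∈-filter⁺ _ x∈ x≢r) fx≡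
  ∈-image-without (inj₁ fx≡nothing)   _  fx≡ | yes refl with () ← trans (sym fx≡nothing) fx≡
  ∈-image-without (inj₂ twin)         _  fx≡ | yes refl with find twin
  ... | x' , x'∈ , x'≢x , fx'≡fx = ∈-mapMaybe⁺ f (∈-filter⁺ _ x'∈ x'≢x) (trans fx'≡fx fx≡)

  image-without-redundant : ∀ {l r} → r ∈ l → Redundant l r →
    ∃ λ ys → length ys ≤ length l ∸ 1 × (∀ {x u} → x ∈ l → f x ≡ just u → u ∈ ys)
  image-without-redundant {l} {r} r∈ redundant =
    mapMaybe f (without r l) , shorter , ∈-image-without redundant
    where
    shorter : length (mapMaybe f (without r l)) ≤ length l ∸ 1
    shorter = ℕ.≤-trans (length-mapMaybe f (without r l))
                (ℕ.∸-monoˡ-≤ 1 (filter-notAll _ l (lose r∈ (λ r≢r → r≢r refl))))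

-- A bounded list is cut into blocks exactly between neighbours a, b with a ∈ L and b ∈ F,
-- which makes the decomposition unique.
module Blocks {T : Set} {F L : T → Set} (F? : Decidable F) (L? : Decidable L) where

  Bounded : List T → Set
  Bounded s = Maybe.All F (head s) × Maybe.All L (last s)

  Uncut : T → T → Set
  Uncut a b = ¬ (L a × F b)

  Block : List T → Set
  Block s = s ≢ [] × Bounded s × Linked Uncut s

  Bounded-++ : ∀ {s t} → Bounded s → Bounded t → Bounded (s ++ t)
  Bounded-++ {s} (fs , ls) (ft , lt) = All-head-++ s fs ft , All-last-++ s ls lt

  Bounded-concat : ∀ {ss} → All Block ss → Bounded (concat ss)
  Bounded-concat []                  = Maybe.nothing , Maybe.nothing
  Bounded-concat ((_ , b , _) ∷ bs) = Bounded-++ b (Bounded-concat bs)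

  private
    split-∷ : ∀ a s → Maybe.All L (last (a ∷ s)) → ∃₂ λ t ss →
      Linked Uncut (a ∷ t) × Maybe.All L (last (a ∷ t)) × All Block ss × (a ∷ t) ++ concat ss ≡ a ∷ s
    split-∷ a []      la = [] , [] , [-] , la , [] , refl
    split-∷ a (b ∷ s) ls with split-∷ b s ls | L? a ×-dec F? b
    ... | t , ss , linked , lt , bs , eq | yes (la , fb) =
      [] , (b ∷ t) ∷ ss , [-] , Maybe.just la , ((λ ()) , (Maybe.just fb , lt) , linked) ∷ bs , cong (a ∷_) eq
    ... | t , ss , linked , lt , bs , eq | no uncut =
      b ∷ t , ss , uncut ∷ linked , lt , bs , cong (a ∷_) eq

    first-block-unique : ∀ {a t a' t' r r'} →
      Linked Uncut (a ∷ t) → Maybe.All L (last (a ∷ t)) →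
      Linked Uncut (a' ∷ t') → Maybe.All L (last (a' ∷ t')) →
      Maybe.All F (head r) → Maybe.All F (head r') →
      (a ∷ t) ++ r ≡ (a' ∷ t') ++ r' → a ∷ t ≡ a' ∷ t'
    first-block-unique {t = []} {t' = []} _ _ _ _ _ _ eq = cong [_] (∷-injectiveˡ eq)
    first-block-unique {t = []} {t' = _ ∷ _} _ (Maybe.just la) (uncut ∷ _) _ fr _ eq
      with refl , refl ← ∷-injective eq = ⊥-elim (uncut (la , Maybe.drop-just fr))
    first-block-unique {t = _ ∷ _} {t' = []} (uncut ∷ _) _ _ (Maybe.just la') _ fr' eq
      with refl , refl ← ∷-injective eq = ⊥-elim (uncut (la' , Maybe.drop-just fr'))
    first-block-unique {t = _ ∷ _} {t' = _ ∷ _} (_ ∷ linked) lt (_ ∷ linked') lt' fr fr' eq =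
      cong₂ _∷_ (∷-injectiveˡ eq) (first-block-unique linked lt linked' lt' fr fr' (∷-injectiveʳ eq))

  split : ∀ {s} → Bounded s → ∃ λ ss → All Block ss × concat ss ≡ s
  split {[]}    _              = [] , [] , refl
  split {a ∷ s} (Maybe.just fa , ls) with split-∷ a s ls
  ... | t , ss , linked , lt , bs , eq = (a ∷ t) ∷ ss , ((λ ()) , (Maybe.just fa , lt) , linked) ∷ bs , eq

  concat-injective : ∀ {ss ss'} → All Block ss → All Block ss' → concat ss ≡ concat ss' → ss ≡ ss'
  concat-injective [] [] _ = refl
  concat-injective [] ((nonempty , _) ∷ _) eq = ⊥-elim (nonempty (++-conicalˡ _ _ (sym eq)))
  concat-injective ((nonempty , _) ∷ _) [] eq = ⊥-elim (nonempty (++-conicalˡ _ _ eq))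
  concat-injective {[] ∷ _} ((nonempty , _) ∷ _) _ _ = ⊥-elim (nonempty refl)
  concat-injective {_} {[] ∷ _} _ ((nonempty , _) ∷ _) _ = ⊥-elim (nonempty refl)
  concat-injective {(a ∷ t) ∷ ss} {(a' ∷ t') ∷ ss'}
    ((_ , (_ , lt) , linked) ∷ bs) ((_ , (_ , lt') , linked') ∷ bs') eq =
    cong₂ _∷_ same-block
      (concat-injective bs bs' (++-cancelˡ (a ∷ t) _ _ (trans eq (cong (_++ concat ss') (sym same-block)))))
    where
    same-block : a ∷ t ≡ a' ∷ t'
    same-block = first-block-unique linked lt linked' lt'
                   (proj₁ (Bounded-concat bs)) (proj₁ (Bounded-concat bs')) eq

module Generated {A : Set} {M C : WSet {A}} (C-code : IsCode C)
  (M⊆C* : M ⊆ Star C) (C*⊆M : Star C ⊆ M) where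

  ε∉C : ¬ C []
  ε∉C Cε with () ← C-code [ [] ] [] (Cε ∷ []) [] refl

  C⊆M : C ⊆ M
  C⊆M c Cc = C*⊆M c ([ c ] , Cc ∷ [] , ++-identityʳ c)

  concat-≢[] : ∀ {c s} → All C (c ∷ s) → concat (c ∷ s) ≢ []
  concat-≢[] {c} {s} (Cc ∷ _) eq = ε∉C (subst C (++-conicalˡ c (concat s) eq) Cc)

  C⊆MinGen : C ⊆ MinGen M
  C⊆MinGen c Cc = (C⊆M c Cc , λ eq → ε∉C (subst C eq Cc)) , indecomposable
    where
    indecomposable : ¬ ∃ λ u → ∃ λ v → M u × u ≢ [] × M v × v ≢ [] × c ≡ u ++ v
    indecomposable (u , v , Mu , u≢[] , Mv , v≢[] , eq) with M⊆C* u Mu | M⊆C* v Mv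
    ... | [] , _ , refl | _ = u≢[] refl
    ... | _ | [] , _ , refl = v≢[] refl
    ... | b ∷ bs , Cbs , refl | d ∷ ds , Cds , refl
      with eq' ← C-code [ c ] ((b ∷ bs) ++ (d ∷ ds)) (Cc ∷ []) (Allₚ.++⁺ Cbs Cds)
                   (trans (++-identityʳ c) (trans eq (concat-++ (b ∷ bs) (d ∷ ds))))
      with () ← ++-conicalʳ bs (d ∷ ds) (sym (∷-injectiveʳ eq'))

  MinGen⊆C : MinGen M ⊆ C
  MinGen⊆C w ((Mw , w≢[]) , indecomposable) with M⊆C* w Mw
  ... | [] , _ , refl = ⊥-elim (w≢[] refl)
  ... | c ∷ [] , Cc ∷ [] , refl = subst C (sym (++-identityʳ c)) Cc
  ... | c ∷ d ∷ s , Cc ∷ Cds , refl =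
    ⊥-elim (indecomposable (c , concat (d ∷ s) , C⊆M c Cc , (λ eq → ε∉C (subst C eq Cc)) ,
                            C*⊆M _ (d ∷ s , Cds , refl) , concat-≢[] Cds , refl))

data Orientation {A : Set} (θ : List A → List A) : Set where
  morphism     : IsMorphism θ → Orientation θ
  antimorphism : IsAntimorphism θ → Orientation θ

module _ {A : Set} {θ : List A → List A} where

  θ-[] : Orientation θ → θ [] ≡ []
  θ-[] (morphism hom)      = ++-identityʳ-unique (θ []) (hom [] [])
  θ-[] (antimorphism anti) = proj₁ anti

  θ-++ : Orientation θ → ∀ u v → θ u ++ θ v ≡ θ (u ++ v) ⊎ θ u ++ θ v ≡ θ (v ++ u)
  θ-++ (morphism hom)      u v = inj₁ (sym (hom u v))
  θ-++ (antimorphism anti) u v = inj₂ (sym (proj₂ anti v u))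

  -- Θ o s is the C-factorisation of θ (concat s) read off from that of concat s.
  Θ : Orientation θ → List (List A) → List (List A)
  Θ (morphism _)     s = map θ s
  Θ (antimorphism _) s = reverse (map θ s)

  concat-Θ : ∀ o s → concat (Θ o s) ≡ θ (concat s)
  concat-Θ o@(morphism hom)      []      = sym (θ-[] o)
  concat-Θ o@(morphism hom)      (x ∷ s) = trans (cong (θ x ++_) (concat-Θ o s)) (sym (hom x (concat s)))
  concat-Θ o@(antimorphism anti) []      = sym (θ-[] o)
  concat-Θ o@(antimorphism anti) (x ∷ s) = begin
    concat (reverse (θ x ∷ map θ s))            ≡⟨ cong concat (unfold-reverse (θ x) (map θ s)) ⟩
    concat (reverse (map θ s) ++ [ θ x ])       ≡⟨ concat-++ (reverse (map θ s)) [ θ x ] ⟨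
    concat (reverse (map θ s)) ++ θ x ++ []     ≡⟨ cong₂ _++_ (concat-Θ o s) (++-identityʳ (θ x)) ⟩
    θ (concat s) ++ θ x                         ≡⟨ proj₂ anti x (concat s) ⟨
    θ (x ++ concat s)                           ∎
    where open ≡-Reasoning

  All-Θ : ∀ {P : List A → Set} o → (∀ {c} → P c → P (θ c)) → ∀ {s} → All P s → All P (Θ o s)
  All-Θ (morphism _)     θ-P Ps = Allₚ.map⁺ (All.map θ-P Ps)
  All-Θ (antimorphism _) θ-P Ps = All-reverse (Allₚ.map⁺ (All.map θ-P Ps))

  front back : Orientation θ → List (List A) → Maybe (List A)
  front (morphism _)     = head
  front (antimorphism _) = last
  back  (morphism _)     = last
  back  (antimorphism _) = head

  head-Θ : ∀ o s → head (Θ o s) ≡ Maybe.map θ (front o s)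
  head-Θ (morphism _)     s = head-map s
  head-Θ (antimorphism _) s = trans (head-reverse (map θ s)) (last-map θ s)

  last-Θ : ∀ o s → last (Θ o s) ≡ Maybe.map θ (back o s)
  last-Θ (morphism _)     s = last-map θ s
  last-Θ (antimorphism _) s = trans (last-reverse (map θ s)) (head-map s)

  ends-reorient : ∀ o {P : (List (List A) → Maybe (List A)) → List A → Set} s →
    (Maybe.All (P head) (head s) × Maybe.All (P last) (last s)) ⇔
    (Maybe.All (P (front o)) (front o s) × Maybe.All (P (back o)) (back o s))
  ends-reorient (morphism _)     s = mk⇔ id id
  ends-reorient (antimorphism _) s = mk⇔ swap swap

  MinGen-θ : ∀ {M} → Injective _≡_ _≡_ θ → Orientation θ → θInvariant θ M →
    ∀ {w} → MinGen M w → MinGen M (θ w)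
  MinGen-θ {M} θ-injective o (θM⊆M , M⊆θM) {w} ((Mw , w≢[]) , indecomposable) =
    (θM⊆M w Mw , λ eq → w≢[] (θ-injective (trans eq (sym (θ-[] o))))) , θ-indecomposable
    where
    preimage : ∀ {u} → M u → u ≢ [] → ∃ λ u' → M u' × u' ≢ [] × θ u' ≡ u
    preimage {u} Mu u≢[] with M⊆θM u Mu
    ... | u' , Mu' , refl = u' , Mu' , (λ { refl → u≢[] (θ-[] o) }) , refl

    θ-indecomposable : ¬ ∃ λ u → ∃ λ v → M u × u ≢ [] × M v × v ≢ [] × θ w ≡ u ++ v
    θ-indecomposable (u , v , Mu , u≢[] , Mv , v≢[] , eq)
      with preimage Mu u≢[] | preimage Mv v≢[]
    ... | u' , Mu' , u'≢[] , refl | v' , Mv' , v'≢[] , refl with θ-++ o u' v'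
    ...   | inj₁ hom  = indecomposable (u' , v' , Mu' , u'≢[] , Mv' , v'≢[] , θ-injective (trans eq hom))
    ...   | inj₂ anti = indecomposable (v' , u' , Mv' , v'≢[] , Mu' , u'≢[] , θ-injective (trans eq anti))

module BoundedFactorisations {A : Set} {C : WSet {A}} (C-code : IsCode C)
  {F L : List A → Set} (F? : Decidable F) (L? : Decidable L) where

  open Blocks F? L? public

  BoundedWords : WSet
  BoundedWords w = ∃ λ s → All C s × concat s ≡ w × Bounded s

  BlockWords : WSet
  BlockWords w = ∃ λ s → All C s × concat s ≡ w × Block s

  private
    flatten : ∀ {zs} → All BlockWords zs →
      ∃ λ ss → All Block ss × All C (concat ss) × map concat ss ≡ zs
    flatten [] = [] , [] , [] , refl
    flatten ((s , Cs , refl , b) ∷ zs) with flatten zs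
    ... | ss , bs , Css , refl = s ∷ ss , b ∷ bs , Allₚ.++⁺ Cs Css , refl

  BlockWords-code : IsCode BlockWords
  BlockWords-code zs zs' Bzs Bzs' eq with flatten Bzs | flatten Bzs'
  ... | ss , bs , Css , refl | ss' , bs' , Css' , refl =
    cong (map concat) (concat-injective bs bs'
      (C-code _ _ Css Css' (trans (sym (List.concat-concat ss)) (trans eq (List.concat-concat ss')))))

  BoundedWords⊆BlockWords* : BoundedWords ⊆ Star BlockWords
  BoundedWords⊆BlockWords* w (s , Cs , refl , bounded) with split bounded
  ... | ss , bs , refl = map concat ss , blocks ss bs Cs , List.concat-concat ss
    where
    blocks : ∀ ss → All Block ss → All C (concat ss) → All BlockWords (map concat ss)
    blocks []       []       _   = []
    blocks (s ∷ ss) (b ∷ bs) Css = (s , Allₚ.++⁻ˡ s Css , refl , b) ∷ blocks ss bs (Allₚ.++⁻ʳ s Css)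

  BlockWords*⊆BoundedWords : Star BlockWords ⊆ BoundedWords
  BlockWords*⊆BoundedWords w (zs , Bzs , refl) with flatten Bzs
  ... | ss , bs , Css , refl = concat ss , Css , sym (List.concat-concat ss) , Bounded-concat bs

  BoundedWords-submonoid : IsSubmonoid BoundedWords
  BoundedWords-submonoid =
    ([] , [] , refl , Maybe.nothing , Maybe.nothing) ,
    λ { u v (s , Cs , refl , bs) (t , Ct , refl , bt) →
          s ++ t , Allₚ.++⁺ Cs Ct , sym (concat-++ s t) , Bounded-++ bs bt }

  BoundedWords-free : IsFreeSubmonoid BoundedWords
  BoundedWords-free = BoundedWords-submonoid , BlockWords , BlockWords-code ,
                      BoundedWords⊆BlockWords* , BlockWords*⊆BoundedWords

module Hull {A : Set} (_≟_ : DecidableEquality A) {θ : List A → List A}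
  (θ-injective : Injective _≡_ _≡_ θ) (o : Orientation θ)
  (xs : List (List A)) (xs-θ : θInvariant θ (_∈ xs))
  {M C : WSet {A}} (C-code : IsCode C) (M⊆C* : M ⊆ Star C) (C*⊆M : Star C ⊆ M)
  (M-θ : θInvariant θ M) (xs⊆M : (_∈ xs) ⊆ M)
  (M-least : ∀ N → IsθInvFreeSubmonoid θ N → (_∈ xs) ⊆ N → M ⊆ N) where

  open Generated C-code M⊆C* C*⊆M
  open DecMembership (List.≡-dec _≟_) using (_∈?_)

  θ-C : ∀ {c} → C c → C (θ c)
  θ-C Cc = MinGen⊆C _ (MinGen-θ θ-injective o M-θ (C⊆MinGen _ Cc))

  -- The C-factorisation of the elements of xs; elsewhere the value is irrelevant.
  factors : List A → List (List A)
  factors x with x ∈? xs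
  ... | yes x∈ = proj₁ (M⊆C* x (xs⊆M x x∈))
  ... | no _   = []

  factors-unique : ∀ {x s} → x ∈ xs → All C s → concat s ≡ x → factors x ≡ s
  factors-unique {x} x∈ Cs eq with x ∈? xs
  ... | no x∉ = ⊥-elim (x∉ x∈)
  ... | yes x∈' with M⊆C* x (xs⊆M x x∈')
  ...   | s' , Cs' , eq' = C-code s' _ Cs' Cs (trans eq' (sym eq))

  factors-factorise : ∀ {x} → x ∈ xs → All C (factors x) × concat (factors x) ≡ x
  factors-factorise {x} x∈ with M⊆C* x (xs⊆M x x∈)
  ... | s , Cs , eq rewrite factors-unique x∈ Cs eq = Cs , eq

  factors-θ : ∀ {x} → x ∈ xs → factors (θ x) ≡ Θ o (factors x)
  factors-θ {x} x∈ with factors-factorise x∈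
  ... | Cs , eq = factors-unique (proj₁ xs-θ x x∈) (All-Θ o θ-C Cs) (trans (concat-Θ o _) (cong θ eq))

  Occurs : (List (List A) → Maybe (List A)) → List A → Set
  Occurs end c = Any (λ x → end (factors x) ≡ just c) xs

  Occurs? : ∀ end → Decidable (Occurs end)
  Occurs? end c = any? (λ x → Maybe.≡-dec (List.≡-dec _≟_) (end (factors x)) (just c)) xs

  end-occurs : ∀ end {x} → x ∈ xs → Maybe.All (Occurs end) (end (factors x))
  end-occurs end {x} x∈ with end (factors x) in eq
  ... | just c  = Maybe.just (lose x∈ eq)
  ... | nothing = Maybe.nothing

  Occurs-θ : ∀ {φ ψ} → (∀ s → φ (Θ o s) ≡ Maybe.map θ (ψ s)) → ∀ c → Occurs ψ c ⇔ Occurs φ (θ c)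
  Occurs-θ {φ} {ψ} φΘ≡θψ c = mk⇔ image preimage
    where
    open ≡-Reasoning
    image : Occurs ψ c → Occurs φ (θ c)
    image occ with x , x∈ , eq ← find occ = lose (proj₁ xs-θ x x∈) (begin
      φ (factors (θ x))           ≡⟨ cong φ (factors-θ x∈) ⟩
      φ (Θ o (factors x))         ≡⟨ φΘ≡θψ (factors x) ⟩
      Maybe.map θ (ψ (factors x)) ≡⟨ cong (Maybe.map θ) eq ⟩
      just (θ c)                  ∎)
    preimage : Occurs φ (θ c) → Occurs ψ c
    preimage occ with x , x∈ , eq ← find occ with proj₂ xs-θ x x∈
    ... | x' , x'∈ , refl = lose x'∈ (Maybe.map-injective θ-injective (begin
      Maybe.map θ (ψ (factors x')) ≡⟨ φΘ≡θψ (factors x') ⟨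
      φ (Θ o (factors x'))         ≡⟨ cong φ (factors-θ x'∈) ⟨
      φ (factors (θ x'))           ≡⟨ eq ⟩
      just (θ c)                   ∎))

  Ends-θ : ∀ {φ ψ} → (∀ s → φ (Θ o s) ≡ Maybe.map θ (ψ s)) →
    ∀ s → Maybe.All (Occurs ψ) (ψ s) ⇔ Maybe.All (Occurs φ) (φ (Θ o s))
  Ends-θ {φ} {ψ} φΘ≡θψ s = mk⇔
    (λ all → subst (Maybe.All (Occurs φ)) (sym (φΘ≡θψ s)) (MaybeAllₚ.gmap (to occurs-θ) all))
    (λ all → Maybe.All-map (from occurs-θ)
               (MaybeAllₚ.map⁻ (subst (Maybe.All (Occurs φ)) (φΘ≡θψ s) all)))
    where
    occurs-θ : ∀ {c} → Occurs ψ c ⇔ Occurs φ (θ c)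
    occurs-θ = Occurs-θ {φ} {ψ} φΘ≡θψ _

  open BoundedFactorisations C-code (Occurs? head) (Occurs? last)

  Bounded-Θ : ∀ s → Bounded s ⇔ Bounded (Θ o s)
  Bounded-Θ s =
    (Ends-θ {φ = head} {ψ = front o} (head-Θ o) s ×-⇔ Ends-θ {φ = last} {ψ = back o} (last-Θ o) s)
      ⇔-∘ ends-reorient o {Occurs} s

  BoundedWords-θ : θInvariant θ BoundedWords
  BoundedWords-θ = image , preimage
    where
    image : ∀ w → BoundedWords w → BoundedWords (θ w)
    image _ (s , Cs , refl , bounded) = Θ o s , All-Θ o θ-C Cs , concat-Θ o s , to (Bounded-Θ s) bounded

    preimage : ∀ w → BoundedWords w → ∃ λ v → BoundedWords v × θ v ≡ w
    preimage _ (s , Cs , refl , bounded) with proj₂ M-θ (concat s) (C*⊆M _ (s , Cs , refl))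
    ... | v , Mv , θv≡ with M⊆C* v Mv
    ...   | s' , Cs' , refl =
      concat s' , (s' , Cs' , refl , from (Bounded-Θ s') (subst Bounded (sym Θs'≡s) bounded)) , θv≡
      where
      Θs'≡s : Θ o s' ≡ s
      Θs'≡s = C-code _ _ (All-Θ o θ-C Cs') Cs (trans (concat-Θ o s') θv≡)

  xs⊆BoundedWords : (_∈ xs) ⊆ BoundedWords
  xs⊆BoundedWords x x∈ with factors-factorise x∈
  ... | Cs , eq = factors x , Cs , eq , end-occurs head x∈ , end-occurs last x∈

  M⊆BoundedWords : M ⊆ BoundedWords
  M⊆BoundedWords = M-least BoundedWords (BoundedWords-free , BoundedWords-θ) xs⊆BoundedWords

  C-occurs-first : ∀ {c} → C c → Occurs head c
  C-occurs-first {c} Cc with M⊆BoundedWords c (C⊆M c Cc)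
  ... | s , Cs , eq , (first , _)
    with refl ← C-code s [ c ] Cs (Cc ∷ []) (trans eq (sym (++-identityʳ c))) = Maybe.drop-just first

  concatMap-factors : ∀ {l} → All (_∈ xs) l →
    All C (concatMap factors l) × concat (concatMap factors l) ≡ concat l
  concatMap-factors [] = [] , refl
  concatMap-factors {x ∷ l} (x∈ ∷ l∈) with factors-factorise x∈ | concatMap-factors l∈
  ... | Cx , eqx | Cl , eql = Allₚ.++⁺ Cx Cl , (begin
    concat (factors x ++ concatMap factors l)            ≡⟨ concat-++ (factors x) _ ⟨
    concat (factors x) ++ concat (concatMap factors l)   ≡⟨ cong₂ _++_ eqx eql ⟩
    x ++ concat l                                        ∎)
    where open ≡-Reasoning

  open Image (List.≡-dec _≟_) (List.≡-dec _≟_) (head ∘ factors)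

  xs-code : TotalInjectiveOn xs → IsCode (_∈ xs)
  xs-code _ [] [] _ _ _ = refl
  xs-code (total , _) [] (y ∷ _) _ (y∈ ∷ _) eq =
    ⊥-elim (total y∈ (cong head (factors-unique y∈ [] (sym (++-conicalˡ y _ (sym eq))))))
  xs-code (total , _) (x ∷ _) [] (x∈ ∷ _) _ eq =
    ⊥-elim (total x∈ (cong head (factors-unique x∈ [] (sym (++-conicalˡ x _ eq)))))
  xs-code ti@(total , injective) (x ∷ l) (y ∷ l') (x∈ ∷ l∈) (y∈ ∷ l'∈) eq =
    cong₂ _∷_ x≡y (xs-code ti l l' l∈ l'∈ (++-cancelˡ x _ _ (trans eq (cong (_++ concat l') (sym x≡y)))))
    where
    open ≡-Reasoning
    same-factors : concatMap factors (x ∷ l) ≡ concatMap factors (y ∷ l')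
    same-factors
      with Cxl , xl≡ ← concatMap-factors (x∈ ∷ l∈) | Cyl , yl≡ ← concatMap-factors (y∈ ∷ l'∈)
      = C-code _ _ Cxl Cyl (trans xl≡ (trans eq (sym yl≡)))
    x≡y : x ≡ y
    x≡y = injective x∈ y∈ (begin
      head (factors x)                            ≡⟨ head-++ (total x∈) ⟨
      head (factors x ++ concatMap factors l)     ≡⟨ cong head same-factors ⟩
      head (factors y ++ concatMap factors l')    ≡⟨ head-++ (total y∈) ⟩
      head (factors y)                            ∎)

  MinGen-bound : ¬ IsCode (_∈ xs) →
    ∃ λ ys → length ys ≤ length xs ∸ 1 × (∀ w → MinGen M w → w ∈ ys)
  MinGen-bound not-code with total-injective-or-redundant xs
  ... | inj₁ total-injective = ⊥-elim (not-code (xs-code total-injective))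
  ... | inj₂ some-redundant with r , r∈ , redundant ← find some-redundant
    with ys , shorter , covers ← image-without-redundant r∈ redundant =
    ys , shorter , λ w generator → first-factor (C-occurs-first (MinGen⊆C w generator))
    where
    first-factor : ∀ {c} → Occurs head c → c ∈ ys
    first-factor occ with x , x∈ , eq ← find occ = covers x∈ eq

theorem1 : {A : Set} → Countable A →
    (θ : List A → List A) → LiteralBijAnti/Morphism θ →
    (xs : List (List A)) → Unique xs →
    θInvariant θ (λ w → w ∈ xs) →
    (M : List A → Set) → IsSmallestθInvFreeHull θ (λ w → w ∈ xs) M →
    ¬ IsCode (λ w → w ∈ xs) →
    ∃ λ (ys : List (List A)) → (length ys ≤ length xs ∸ 1) × (∀ w → MinGen M w → w ∈ ys)
theorem1 countable θ ((θ-injective , _) , _ , hom⊎anti) xs _ xs-θ M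
  (((_ , C , C-code , M⊆C* , C*⊆M) , M-θ) , xs⊆M , M-least) =
  Hull.MinGen-bound (Countable⇒DecidableEquality countable) θ-injective orientation
    xs xs-θ C-code M⊆C* C*⊆M M-θ xs⊆M M-least
  where
  orientation : Orientation θ
  orientation = [ morphism , antimorphism ]′ hom⊎anti
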